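{- For an integer $n\ge 3$, let $W_{n+1}=C_n+K_1$ be the wheel graph on $n+1$ vertices. Then $\varphi(W_{n+1}^2)=\frac{1}{2}n(n-1)$.
   Context: All graphs are simple and finite. $C_n+K_1$ denotes the join of the cycle $C_n$ with a single vertex (a new vertex adjacent to all vertices of $C_n$). $\mathbb{N}_0$ denotes the set of non-negative integers. For non-empty $A,B\subseteq\mathbb{N}_0$, $A+B=\{a+b: a\in A, b\in B\}$. An integer additive set-indexer (IASI) of a graph $G$ is an injective function $f:V(G)\to\mathcal{P}(\mathbb{N}_0)$ with non-empty values such that the induced map $f^+(uv)=f(u)+f(v)$ on $E(G)$ is also injective. An IASI is weak if $|f^+(uv)|=\max(|f(u)|,|f(v)|)$ for every edge $uv$. An element (vertex or edge) is mono-indexed if its set-label has cardinality $1$. The sparing number $\varphi(H)$ of a graph $H$ is the minimum number of mono-indexed edges over all weak IASIs of $H$. The square $G^2$ of $G$ has vertex set $V(G)$, two distinct vertices adjacent iff their distance in $G$ is at most $2$. -}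

module Defs where

open import Data.Nat using (ℕ; zero; suc; _+_; _*_; _∸_; _⊔_; _≤_; _≡ᵇ_; _<ᵇ_)
open import Data.Nat.DivMod using (_%_)
import Data.Nat as ℕ
open import Data.Bool using (Bool; true; false; _∧_; _∨_; not; if_then_else_; T)
open import Data.Fin using (Fin; zero; suc; toℕ)
import Data.Fin as F
open import Data.List using (List; []; _∷_; length; map; concatMap; deduplicate; allFin)
open import Data.Bool.ListAction using (any)
open import Data.Nat.ListAction using (sum)
open import Data.List.Membership.Propositional using (_∈_)
open import Data.Product using (Σ; _×_; ∃; _,_)
open import Data.Sum using (_⊎_)
open import Function.Bundles using (_⇔_)
open import Relation.Binary.PropositionalEquality using (_≡_; _≢_)
open import Relation.Nullary.Decidable using (⌊_⌋)

-- A simple graph on vertex set Fin m, given by a Boolean adjacency function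
-- (the graphs we build are symmetric and irreflexive).
Graph : ℕ → Set
Graph m = Fin m → Fin m → Bool

cycAdj : (n : ℕ) → Fin n → Fin n → Bool
cycAdj (suc k) i j =
  (toℕ j ≡ᵇ ((toℕ i + 1) % suc k)) ∨ (toℕ i ≡ᵇ ((toℕ j + 1) % suc k))

-- Wheel W_{n+1} = C_n + K_1 on Fin (suc n): vertex zero is the hub,
-- vertex suc i is the i-th cycle vertex.
wheel : (n : ℕ) → Graph (suc n)
wheel n zero    zero    = false
wheel n zero    (suc j) = true
wheel n (suc i) zero    = true
wheel n (suc i) (suc j) = cycAdj n i j

square : {m : ℕ} → Graph m → Graph m
square {m} G u v =
  not ⌊ u F.≟ v ⌋ ∧ (G u v ∨ any (λ w → G u w ∧ G w v) (allFin m))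

-- Finite subsets of ℕ₀ are represented by lists (duplicates/order irrelevant).
SameSet : List ℕ → List ℕ → Set
SameSet A B = ∀ x → (x ∈ A) ⇔ (x ∈ B)

card : List ℕ → ℕ
card A = length (deduplicate ℕ._≟_ A)

sumset : List ℕ → List ℕ → List ℕ
sumset A B = concatMap (λ a → map (a +_) B) A

IsIASI : {m : ℕ} → Graph m → (Fin m → List ℕ) → Set
IsIASI {m} G f =
  (∀ u → f u ≢ [])
  × (∀ u v → SameSet (f u) (f v) → u ≡ v)
  × (∀ u v u' v' → T (G u v) → T (G u' v') →
       SameSet (sumset (f u) (f v)) (sumset (f u') (f v')) →
       (u ≡ u' × v ≡ v') ⊎ (u ≡ v' × v ≡ u'))

IsWeakIASI : {m : ℕ} → Graph m → (Fin m → List ℕ) → Set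
IsWeakIASI G f =
  IsIASI G f × (∀ u v → T (G u v) → card (sumset (f u) (f v)) ≡ card (f u) ⊔ card (f v))

monoCount : {m : ℕ} → Graph m → (Fin m → List ℕ) → ℕ
monoCount {m} G f =
  sum (map (λ i → sum (map (λ j →
        if G i j ∧ (toℕ i <ᵇ toℕ j) ∧ (card (sumset (f i) (f j)) ≡ᵇ 1) then 1 else 0)
       (allFin m))) (allFin m))

IsSparingNumber : {m : ℕ} → Graph m → ℕ → Set
IsSparingNumber {m} G k =
  (Σ (Fin m → List ℕ) λ f → IsWeakIASI G f × monoCount G f ≡ k)
  × (∀ f → IsWeakIASI G f → k ≤ monoCount G f)

module Submission where

-- The square of the wheel W_{n+1} = C_n + K_1 is the complete graph K_{n+1}
-- (two rim vertices share the hub as a neighbour), so the theorem says that a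
-- complete graph on n + 1 vertices has sparing number n(n-1)/2.
--
-- Lower bound: if |A|, |B| ≥ 2 then |A + B| > max(|A|, |B|), so a weak IASI of a
-- complete graph leaves at most one vertex with a label of size ≥ 2; an edge is
-- mono-indexed iff both ends are, giving at least n(n-1)/2 mono-indexed edges.
-- Upper bound: label the hub {1, 2} and rim vertex u by {2^u}.  Each edge label
-- has least element 2^u + 2^v, and these sums are pairwise distinct, so this is
-- a weak IASI of every loopless graph, with exactly the rim edges mono-indexed.

open import Defs
open import Data.Nat using (ℕ; _*_; _∸_; _≤_)
open import Data.Nat.DivMod using (_/_)

open import Data.Nat using (zero; suc; _+_; _^_; _<_; _⊔_; _<ᵇ_; _≡ᵇ_; z≤n; s≤s; s≤s⁻¹)
open import Data.Nat.Properties
open import Data.Nat.DivMod using (m*n/n≡m; /-monoˡ-≤)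
open import Data.Nat.Logarithm using (⌊log₂_⌋; ⌊log₂[2^n]⌋≡n)
import Data.Nat.ListAction as ListAction
open import Data.Nat.Solver using (module +-*-Solver)
open import Algebra.Properties.Monoid.Sum +-0-monoid
  using (sum-syntax; sum-cong-≗; sum-replicate-zero)
open import Data.Bool using (Bool; true; false; _∧_; if_then_else_; T)
open import Data.Bool.Properties using (∧-zeroʳ; ∨-zeroʳ; T-≡)
open import Data.Unit using (tt)
open import Data.Fin using (Fin; zero; suc; toℕ)
import Data.Fin as Fin
open import Data.Fin.Properties using (toℕ-injective) renaming (suc-injective to suc-injectiveᶠ)
open import Data.List using (List; []; _∷_; length; map; tabulate; allFin; deduplicate)
open import Data.List.Properties using (length-map; length-removeAt′; map-tabulate)
open import Data.List.Extrema.Nat using (min; argmin-all; min≤⊤; min≤xs)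
open import Data.List.Membership.Propositional using (_∈_)
open import Data.List.Membership.Propositional.Properties
  using (∈-++⁺ˡ; ∈-++⁺ʳ; ∈-++⁻; ∈-map⁺; ∈-map⁻; ∈-deduplicate⁺; ∈-deduplicate⁻)
open import Data.List.Relation.Unary.Any using (here; there; _─_)
open import Data.List.Relation.Unary.All as All using (_∷_)
import Data.List.Relation.Unary.All.Properties as Allₚ
open import Data.List.Relation.Unary.AllPairs using ([]; _∷_)
open import Data.List.Relation.Unary.Unique.Propositional using (Unique)
import Data.List.Relation.Unary.Unique.Propositional.Properties as Uniqueₚ
open import Data.List.Relation.Unary.Unique.DecPropositional.Properties using (deduplicate-!)
open import Data.Product using (∃; ∃₂; _×_; _,_; proj₁; proj₂; swap)
open import Data.Sum using (_⊎_; inj₁; inj₂)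
open import Data.Empty using (⊥-elim)
open import Function using (id; _∘_)
open import Function.Bundles using (Equivalence)
open import Relation.Binary.PropositionalEquality
open import Relation.Binary.Definitions using (tri<; tri≈; tri>)
open import Relation.Nullary using (yes; no)

sumset⁺ : ∀ {a b} (A B : List ℕ) → a ∈ A → b ∈ B → a + b ∈ sumset A B
sumset⁺ (x ∷ A) B (here refl) b∈B = ∈-++⁺ˡ (∈-map⁺ (x +_) b∈B)
sumset⁺ (x ∷ A) B (there a∈A) b∈B = ∈-++⁺ʳ (map (x +_) B) (sumset⁺ A B a∈A b∈B)

sumset⁻ : ∀ {z} (A B : List ℕ) → z ∈ sumset A B →
          ∃₂ λ a b → a ∈ A × b ∈ B × z ≡ a + b
sumset⁻ (x ∷ A) B z∈ with ∈-++⁻ (map (x +_) B) z∈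
... | inj₁ z∈xB with ∈-map⁻ (x +_) z∈xB
...   | b , b∈B , z≡x+b = x , b , here refl , b∈B , z≡x+b
sumset⁻ (x ∷ A) B z∈ | inj₂ z∈AB with sumset⁻ A B z∈AB
... | a , b , a∈A , b∈B , z≡a+b = a , b , there a∈A , b∈B , z≡a+b

sumset-comm : ∀ {z} (A B : List ℕ) → z ∈ sumset B A → z ∈ sumset A B
sumset-comm A B z∈ with sumset⁻ B A z∈
... | b , a , b∈B , a∈A , refl = subst (_∈ sumset A B) (+-comm a b) (sumset⁺ A B a∈A b∈B)

IsLeast : ℕ → List ℕ → Set
IsLeast x A = x ∈ A × (∀ {y} → y ∈ A → x ≤ y)

least : ∀ b B → ∃ λ m → IsLeast m (b ∷ B)
least b B = min b B
          , argmin-all id (here refl) (All.tabulate there)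
          , All.lookup (min≤⊤ b B ∷ min≤xs b B)

least-unique : ∀ {x y A B} → SameSet A B → IsLeast x A → IsLeast y B → x ≡ y
least-unique A≈B (x∈A , x≤A) (y∈B , y≤B) =
  ≤-antisym (x≤A (Equivalence.from (A≈B _) y∈B)) (y≤B (Equivalence.to (A≈B _) x∈A))

least-sumset : ∀ {a b A B} → IsLeast a A → IsLeast b B → IsLeast (a + b) (sumset A B)
least-sumset {a} {b} {A} {B} (a∈A , a≤A) (b∈B , b≤B) = sumset⁺ A B a∈A b∈B , a+b≤
  where
  a+b≤ : ∀ {z} → z ∈ sumset A B → a + b ≤ z
  a+b≤ z∈ with sumset⁻ A B z∈
  ... | a′ , b′ , a′∈A , b′∈B , refl = +-mono-≤ (a≤A a′∈A) (b≤B b′∈B)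

∈-─ : ∀ {x y} (ys : List ℕ) → y ∈ ys → y ≢ x → (x∈ys : x ∈ ys) → y ∈ (ys ─ x∈ys)
∈-─ (w ∷ ys) (here refl) y≢x (here refl) = ⊥-elim (y≢x refl)
∈-─ (w ∷ ys) (there y∈) y≢x (here _)     = y∈
∈-─ (w ∷ ys) (here refl) y≢x (there _)   = here refl
∈-─ (w ∷ ys) (there y∈) y≢x (there x∈)   = there (∈-─ ys y∈ y≢x x∈)

unique-length-≤ : ∀ {xs} (ys : List ℕ) → Unique xs → (∀ {z} → z ∈ xs → z ∈ ys) →
                  length xs ≤ length ys
unique-length-≤ ys [] xs⊆ys = z≤n
unique-length-≤ {x ∷ xs} ys (x∉xs ∷ xs!) xs⊆ys =
  subst (suc (length xs) ≤_) (sym (length-removeAt′ ys _))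
    (s≤s (unique-length-≤ (ys ─ x∈ys) xs! λ z∈xs →
      ∈-─ ys (xs⊆ys (there z∈xs)) (λ z≡x → All.lookup x∉xs z∈xs (sym z≡x)) x∈ys))
  where
  x∈ys : x ∈ ys
  x∈ys = xs⊆ys (here refl)

card-≥ : ∀ {L} (X : List ℕ) → Unique L → (∀ {z} → z ∈ L → z ∈ X) → length L ≤ card X
card-≥ X L! L⊆X = unique-length-≤ (deduplicate _≟_ X) L! (λ z∈L → ∈-deduplicate⁺ _≟_ (L⊆X z∈L))

card-mono : ∀ {X Y} → (∀ {z} → z ∈ X → z ∈ Y) → card X ≤ card Y
card-mono {X} {Y} X⊆Y = card-≥ Y (deduplicate-! _≟_ X) (λ z∈ → X⊆Y (∈-deduplicate⁻ _≟_ X z∈))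

-- If A contains a₁ < a₂, then A + B has more elements than B: the sums
-- a₂ + b (b ∈ B) are distinct and all exceed a₁ + min B.
card-sumset-grows : ∀ {a₁ a₂} (A B : List ℕ) → a₁ ∈ A → a₂ ∈ A → a₁ < a₂ → B ≢ [] →
                    suc (card B) ≤ card (sumset A B)
card-sumset-grows A [] _ _ _ B≢[] = ⊥-elim (B≢[] refl)
card-sumset-grows {a₁} {a₂} A (b ∷ B) a₁∈A a₂∈A a₁<a₂ _ =
  subst (_≤ card (sumset A (b ∷ B))) (cong suc (length-map (a₂ +_) D))
    (card-≥ (sumset A (b ∷ B)) L! L⊆A+B)
  where
  D : List ℕ
  D = deduplicate _≟_ (b ∷ B)
  m : ℕ
  m = proj₁ (least b B)
  m-least : IsLeast m (b ∷ B)
  m-least = proj₂ (least b B)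
  L : List ℕ
  L = a₁ + m ∷ map (a₂ +_) D

  below : ∀ {d} → d ∈ D → a₁ + m < a₂ + d
  below d∈D = +-mono-<-≤ a₁<a₂ (proj₂ m-least (∈-deduplicate⁻ _≟_ (b ∷ B) d∈D))

  L! : Unique L
  L! = Allₚ.map⁺ (All.tabulate λ d∈D eq → <-irrefl eq (below d∈D))
     ∷ Uniqueₚ.map⁺ (+-cancelˡ-≡ a₂ _ _) (deduplicate-! _≟_ (b ∷ B))

  L⊆A+B : ∀ {z} → z ∈ L → z ∈ sumset A (b ∷ B)
  L⊆A+B (here refl) = sumset⁺ A (b ∷ B) a₁∈A (proj₁ m-least)
  L⊆A+B (there z∈) with ∈-map⁻ (a₂ +_) z∈
  ... | d , d∈D , refl = sumset⁺ A (b ∷ B) a₂∈A (∈-deduplicate⁻ _≟_ (b ∷ B) d∈D)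

two-elements : (X : List ℕ) → 2 ≤ card X → ∃₂ λ x y → x ∈ X × y ∈ X × x < y
two-elements X 2≤ = ordered (deduplicate _≟_ X) (deduplicate-! _≟_ X) (∈-deduplicate⁻ _≟_ X) 2≤
  where
  ordered : ∀ D → Unique D → (∀ {z} → z ∈ D → z ∈ X) → 2 ≤ length D →
            ∃₂ λ x y → x ∈ X × y ∈ X × x < y
  ordered (_ ∷ []) _ _ (s≤s ())
  ordered (x ∷ y ∷ D) ((x≢y ∷ _) ∷ _) D⊆X _ with <-cmp x y
  ... | tri< x<y _ _ = x , y , D⊆X (here refl) , D⊆X (there (here refl)) , x<y
  ... | tri≈ _ x≡y _ = ⊥-elim (x≢y x≡y)
  ... | tri> _ _ y<x = y , x , D⊆X (there (here refl)) , D⊆X (here refl) , y<x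

card≥2⇒≢[] : ∀ {A} → 2 ≤ card A → A ≢ []
card≥2⇒≢[] {[]} ()
card≥2⇒≢[] {x ∷ A} _ ()

card-sumset-growsʳ : ∀ (A B : List ℕ) → 2 ≤ card A → B ≢ [] → card B < card (sumset A B)
card-sumset-growsʳ A B 2≤A B≢[] with two-elements A 2≤A
... | a₁ , a₂ , a₁∈A , a₂∈A , a₁<a₂ = card-sumset-grows A B a₁∈A a₂∈A a₁<a₂ B≢[]

card-sumset-growsˡ : ∀ (A B : List ℕ) → A ≢ [] → 2 ≤ card B → card A < card (sumset A B)
card-sumset-growsˡ A B A≢[] 2≤B =
  ≤-trans (card-sumset-growsʳ B A 2≤B A≢[]) (card-mono (sumset-comm A B))

sumset-exceeds-max : ∀ (A B : List ℕ) → 2 ≤ card A → 2 ≤ card B →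
                     card A ⊔ card B < card (sumset A B)
sumset-exceeds-max A B 2≤A 2≤B =
  ⊔-lub (card-sumset-growsˡ A B (card≥2⇒≢[] 2≤A) 2≤B)
        (card-sumset-growsʳ A B 2≤A (card≥2⇒≢[] 2≤B))

two-large-not-weak : ∀ (A B : List ℕ) → 2 ≤ card A → 2 ≤ card B →
                     card (sumset A B) ≢ card A ⊔ card B
two-large-not-weak A B 2≤A 2≤B = >⇒≢ (sumset-exceeds-max A B 2≤A 2≤B)

2^-injective : ∀ {a b} → 2 ^ a ≡ 2 ^ b → a ≡ b
2^-injective {a} {b} eq =
  trans (sym (⌊log₂[2^n]⌋≡n a)) (trans (cong ⌊log₂_⌋ eq) (⌊log₂[2^n]⌋≡n b))

pow2-sum-below : ∀ {a b} → a < b → 2 ^ a + 2 ^ b < 2 ^ suc b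
pow2-sum-below {a} {b} a<b =
  subst (2 ^ a + 2 ^ b <_) (cong (2 ^ b +_) (sym (+-identityʳ (2 ^ b))))
    (+-monoˡ-< (2 ^ b) (^-monoʳ-< 2 (s≤s (s≤s z≤n)) a<b))

pow2-sum-top : ∀ {a b c d} → a < b → c < d → 2 ^ a + 2 ^ b ≡ 2 ^ c + 2 ^ d → b ≡ d
pow2-sum-top {a} {b} {c} {d} a<b c<d eq with <-cmp b d
... | tri≈ _ b≡d _ = b≡d
... | tri< b<d _ _ = ⊥-elim (<-irrefl eq
        (<-≤-trans (pow2-sum-below a<b) (≤-trans (^-monoʳ-≤ 2 b<d) (m≤n+m (2 ^ d) (2 ^ c)))))
... | tri> _ _ d<b = ⊥-elim (<-irrefl (sym eq)
        (<-≤-trans (pow2-sum-below c<d) (≤-trans (^-monoʳ-≤ 2 d<b) (m≤n+m (2 ^ b) (2 ^ a)))))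

pow2-sum-ordered : ∀ {a b c d} → a < b → c < d → 2 ^ a + 2 ^ b ≡ 2 ^ c + 2 ^ d →
                   a ≡ c × b ≡ d
pow2-sum-ordered {a} {b} {c} a<b c<d eq with pow2-sum-top a<b c<d eq
... | refl = 2^-injective (+-cancelʳ-≡ (2 ^ b) (2 ^ a) (2 ^ c) eq) , refl

pow2-sum-injective : ∀ {a b c d} → a ≢ b → c ≢ d → 2 ^ a + 2 ^ b ≡ 2 ^ c + 2 ^ d →
                     (a ≡ c × b ≡ d) ⊎ (a ≡ d × b ≡ c)
pow2-sum-injective {a} {b} {c} {d} a≢b c≢d eq with <-cmp a b | <-cmp c d
... | tri≈ _ a≡b _ | _            = ⊥-elim (a≢b a≡b)
... | _            | tri≈ _ c≡d _ = ⊥-elim (c≢d c≡d)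
... | tri< a<b _ _ | tri< c<d _ _ = inj₁ (pow2-sum-ordered a<b c<d eq)
... | tri< a<b _ _ | tri> _ _ d<c = inj₂ (pow2-sum-ordered a<b d<c (trans eq (+-comm (2 ^ c) _)))
... | tri> _ _ b<a | tri< c<d _ _ = inj₂ (swap (pow2-sum-ordered b<a c<d (trans (+-comm (2 ^ b) _) eq)))
... | tri> _ _ b<a | tri> _ _ d<c =
  inj₁ (swap (pow2-sum-ordered b<a d<c (trans (+-comm (2 ^ b) _) (trans eq (+-comm (2 ^ c) _)))))

card-pair : ∀ x y → x ≢ y → card (x ∷ y ∷ []) ≡ 2
card-pair x y x≢y with x ≡ᵇ y in x≡ᵇy
... | true  = ⊥-elim (x≢y (≡ᵇ⇒≡ x y (subst T (sym x≡ᵇy) tt)))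
... | false = refl

Loopless : ∀ {m} → Graph m → Set
Loopless {m} G = ∀ (u v : Fin m) → T (G u v) → u ≢ v

weight : ∀ {m} → Fin m → ℕ
weight u = 2 ^ toℕ u

label : ∀ {n} → Fin (suc n) → List ℕ
label zero    = 1 ∷ 2 ∷ []
label (suc i) = weight (suc i) ∷ []

least-label : ∀ {n} (u : Fin (suc n)) → IsLeast (weight u) (label u)
least-label zero    = here refl , λ { (here refl) → ≤-refl ; (there (here refl)) → n≤1+n 1 }
least-label (suc i) = here refl , λ { (here refl) → ≤-refl }

least-edge-label : ∀ {n} (u v : Fin (suc n)) →
                   IsLeast (weight u + weight v) (sumset (label u) (label v))
least-edge-label u v = least-sumset (least-label u) (least-label v)

label-injective : ∀ {n} (u v : Fin (suc n)) → SameSet (label u) (label v) → u ≡ v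
label-injective u v same =
  toℕ-injective (2^-injective (least-unique same (least-label u) (least-label v)))

-- Distinct edges get distinct labels, because their least elements are
-- different sums of two distinct powers of 2.
edge-label-injective : ∀ {n} (u v u′ v′ : Fin (suc n)) → u ≢ v → u′ ≢ v′ →
  SameSet (sumset (label u) (label v)) (sumset (label u′) (label v′)) →
  (u ≡ u′ × v ≡ v′) ⊎ (u ≡ v′ × v ≡ u′)
edge-label-injective u v u′ v′ u≢v u′≢v′ same
  with pow2-sum-injective (u≢v ∘ toℕ-injective) (u′≢v′ ∘ toℕ-injective)
         (least-unique same (least-edge-label u v) (least-edge-label u′ v′))
... | inj₁ (u≡u′ , v≡v′) = inj₁ (toℕ-injective u≡u′ , toℕ-injective v≡v′)
... | inj₂ (u≡v′ , v≡u′) = inj₂ (toℕ-injective u≡v′ , toℕ-injective v≡u′)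

-- Each edge label has exactly max(|f u|, |f v|) elements: a hub edge gets
-- {2^v + 1, 2^v + 2}, any other edge a singleton.
label-weak : ∀ {n} (u v : Fin (suc n)) → u ≢ v →
             card (sumset (label u) (label v)) ≡ card (label u) ⊔ card (label v)
label-weak zero    zero    u≢v = ⊥-elim (u≢v refl)
label-weak zero    (suc j) _   = card-pair (1 + weight (suc j)) (2 + weight (suc j)) (1+n≢n ∘ sym)
label-weak (suc i) zero    _   = card-pair (weight (suc i) + 1) (weight (suc i) + 2) ((λ ()) ∘ +-cancelˡ-≡ (weight (suc i)) 1 2)
label-weak (suc i) (suc j) _   = refl

label-isWeakIASI : ∀ {n} (G : Graph (suc n)) → Loopless G → IsWeakIASI G label
label-isWeakIASI G loopless =
  ( (λ { zero () ; (suc _) () })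
  , label-injective
  , λ u v u′ v′ uv u′v′ → edge-label-injective u v u′ v′ (loopless u v uv) (loopless u′ v′ u′v′) )
  , λ u v uv → label-weak u v (loopless u v uv)

⟦_⟧ : Bool → ℕ
⟦ b ⟧ = if b then 1 else 0

countTrue : ∀ {m} → (Fin m → Bool) → ℕ
countTrue {m} s = ∑[ i < m ] ⟦ s i ⟧

truePairs : ∀ {m} → (Fin m → Bool) → ℕ
truePairs {m} s = ∑[ i < m ] ∑[ j < m ] ⟦ (toℕ i <ᵇ toℕ j) ∧ (s i ∧ s j) ⟧

-- Counting ordered pairs of marked elements: 2·P + c = c² (the c² pairs are
-- the c diagonal ones and each unordered pair i < j twice).
truePairs-count : ∀ {m} (s : Fin m → Bool) → 2 * truePairs s + countTrue s ≡ countTrue s * countTrue s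
truePairs-count {zero} s = refl
truePairs-count {suc m} s with s zero | truePairs-count (λ i → s (suc i))
... | false | ih = trans (cong (λ r → 2 * (r + truePairs (λ i → s (suc i))) + countTrue (λ i → s (suc i)))
                               (sum-replicate-zero m)) ih
... | true  | ih = begin
    2 * (c + p) + suc c         ≡⟨ solve 2 (λ c p → con 2 :* (c :+ p) :+ (con 1 :+ c)
                                                 := (con 2 :* p :+ c) :+ (con 1 :+ con 2 :* c)) refl c p ⟩
    (2 * p + c) + (1 + 2 * c)   ≡⟨ cong (_+ (1 + 2 * c)) ih ⟩
    c * c + (1 + 2 * c)         ≡⟨ solve 1 (λ c → c :* c :+ (con 1 :+ con 2 :* c)
                                                 := (con 1 :+ c) :* (con 1 :+ c)) refl c ⟩
    suc c * suc c               ∎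
  where
  open ≡-Reasoning
  open +-*-Solver
  c : ℕ
  c = countTrue (λ i → s (suc i))
  p : ℕ
  p = truePairs (λ i → s (suc i))

pairsOf : ℕ → ℕ
pairsOf c = (c * (c ∸ 1)) / 2

pairsOf-mono : ∀ {a b} → a ≤ b → pairsOf a ≤ pairsOf b
pairsOf-mono a≤b = /-monoˡ-≤ 2 (*-mono-≤ a≤b (∸-monoˡ-≤ 1 a≤b))

half-from-square : ∀ p c → 2 * p + c ≡ c * c → p ≡ pairsOf c
half-from-square p c eq = sym (begin
    (c * (c ∸ 1)) / 2  ≡⟨ cong (_/ 2) twice ⟩
    (2 * p) / 2        ≡⟨ cong (_/ 2) (*-comm 2 p) ⟩
    (p * 2) / 2        ≡⟨ m*n/n≡m p 2 ⟩
    p                  ∎)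
  where
  open ≡-Reasoning
  twice : c * (c ∸ 1) ≡ 2 * p
  twice = begin
    c * (c ∸ 1)      ≡⟨ *-distribˡ-∸ c c 1 ⟩
    c * c ∸ c * 1    ≡⟨ cong₂ _∸_ (sym eq) (*-identityʳ c) ⟩
    2 * p + c ∸ c    ≡⟨ m+n∸n≡m (2 * p) c ⟩
    2 * p            ∎

truePairs-closed : ∀ {m} (s : Fin m → Bool) →
                   truePairs s ≡ pairsOf (countTrue s)
truePairs-closed s = half-from-square (truePairs s) (countTrue s) (truePairs-count s)

countTrue-all : ∀ {m} (s : Fin m → Bool) → (∀ i → s i ≡ true) → countTrue s ≡ m
countTrue-all {zero}  s all = refl
countTrue-all {suc m} s all rewrite all zero = cong suc (countTrue-all (λ i → s (suc i)) (λ i → all (suc i)))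

countTrue-one-exception : ∀ {m} (s : Fin m → Bool) →
  (∀ i j → s i ≡ false → s j ≡ false → i ≡ j) → m ≤ suc (countTrue s)
countTrue-one-exception {zero}  s unique = z≤n
countTrue-one-exception {suc m} s unique with s zero in s0
... | true  = s≤s (countTrue-one-exception (λ i → s (suc i))
                     λ i j si sj → suc-injectiveᶠ (unique (suc i) (suc j) si sj))
... | false = s≤s (≤-reflexive (sym (countTrue-all (λ i → s (suc i)) rest)))
  where
  rest : ∀ i → s (suc i) ≡ true
  rest i with s (suc i) in si
  ... | true  = refl
  ... | false with unique zero (suc i) s0 si
  ...   | ()

sum-allFin : ∀ m (F : Fin m → ℕ) → ListAction.sum (map F (allFin m)) ≡ ∑[ i < m ] F i
sum-allFin m F = trans (cong ListAction.sum (map-tabulate id F)) (sum-tabulate m F)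
  where
  sum-tabulate : ∀ m (F : Fin m → ℕ) → ListAction.sum (tabulate F) ≡ ∑[ i < m ] F i
  sum-tabulate zero    F = refl
  sum-tabulate (suc m) F = cong (F zero +_) (sum-tabulate m (λ i → F (suc i)))

Complete : ∀ {m} → Graph m → Set
Complete {m} G = ∀ (u v : Fin m) → u ≢ v → T (G u v)

isMono : ∀ {m} → (Fin m → List ℕ) → Fin m → Bool
isMono f i = card (f i) ≡ᵇ 1

card≥1 : ∀ {A} → A ≢ [] → 1 ≤ card A
card≥1 {[]}    A≢[] = ⊥-elim (A≢[] refl)
card≥1 {x ∷ A} _    = s≤s z≤n

-- Between sizes ≥ 1, max(a, b) = 1 iff a = 1 and b = 1: under a weak IASI an
-- edge is mono-indexed iff both its ends are.
⊔≡ᵇ1 : ∀ a b → 1 ≤ a → 1 ≤ b → ((a ⊔ b) ≡ᵇ 1) ≡ (a ≡ᵇ 1) ∧ (b ≡ᵇ 1)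
⊔≡ᵇ1 (suc zero)    (suc b)       _ _ = refl
⊔≡ᵇ1 (suc (suc a)) (suc zero)    _ _ = refl
⊔≡ᵇ1 (suc (suc a)) (suc (suc b)) _ _ = refl

<ᵇ⇒≢ : ∀ {m} {i j : Fin m} → (toℕ i <ᵇ toℕ j) ≡ true → i ≢ j
<ᵇ⇒≢ {i = i} i<j refl = <-irrefl refl (<ᵇ⇒< (toℕ i) (toℕ i) (subst T (sym i<j) tt))

module _ {m} (G : Graph m) (complete : Complete G) (f : Fin m → List ℕ) (weak : IsWeakIASI G f) where

  private
    nonEmpty : ∀ u → f u ≢ []
    nonEmpty = proj₁ (proj₁ weak)

    max-card : ∀ u v → T (G u v) → card (sumset (f u) (f v)) ≡ card (f u) ⊔ card (f v)
    max-card = proj₂ weak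

    edge : ∀ {i j : Fin m} → i ≢ j → G i j ≡ true
    edge {i} {j} i≢j = Equivalence.to T-≡ (complete i j i≢j)

  monoCount-complete : monoCount G f ≡ truePairs (isMono f)
  monoCount-complete =
    trans (sum-allFin m _) (sum-cong-≗ λ i →
      trans (sum-allFin m _) (sum-cong-≗ λ j → cong ⟦_⟧ (mono-edge i j)))
    where
    mono-edge : ∀ i j → G i j ∧ (toℕ i <ᵇ toℕ j) ∧ (card (sumset (f i) (f j)) ≡ᵇ 1)
                      ≡ (toℕ i <ᵇ toℕ j) ∧ (isMono f i ∧ isMono f j)
    mono-edge i j with toℕ i <ᵇ toℕ j in i<j
    ... | false = ∧-zeroʳ (G i j)
    ... | true  = begin
      G i j ∧ (card (sumset (f i) (f j)) ≡ᵇ 1)  ≡⟨ cong (_∧ _) (edge i≢j) ⟩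
      card (sumset (f i) (f j)) ≡ᵇ 1            ≡⟨ cong (_≡ᵇ 1) (max-card i j (complete i j i≢j)) ⟩
      (card (f i) ⊔ card (f j)) ≡ᵇ 1            ≡⟨ ⊔≡ᵇ1 _ _ (card≥1 (nonEmpty i)) (card≥1 (nonEmpty j)) ⟩
      isMono f i ∧ isMono f j                   ∎
      where
      open ≡-Reasoning
      i≢j : i ≢ j
      i≢j = <ᵇ⇒≢ i<j

  one-non-mono : ∀ i j → isMono f i ≡ false → isMono f j ≡ false → i ≡ j
  one-non-mono i j i-large j-large with i Fin.≟ j
  ... | yes i≡j = i≡j
  ... | no  i≢j = ⊥-elim (two-large-not-weak (f i) (f j)
                    (≥2 (card≥1 (nonEmpty i)) i-large) (≥2 (card≥1 (nonEmpty j)) j-large)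
                    (max-card i j (complete i j i≢j)))
    where
    ≥2 : ∀ {a} → 1 ≤ a → (a ≡ᵇ 1) ≡ false → 2 ≤ a
    ≥2 {suc (suc a)} _ _ = s≤s (s≤s z≤n)

sparing-complete : ∀ {n} (G : Graph (suc n)) → Complete G → Loopless G →
                   IsSparingNumber G (pairsOf n)
sparing-complete {n} G complete loopless =
  (label , label-isWeakIASI G loopless , optimal) , lower-bound
  where
  optimal : monoCount G (label {n}) ≡ pairsOf n
  optimal = begin
    monoCount G f₀                  ≡⟨ monoCount-complete G complete f₀ (label-isWeakIASI G loopless) ⟩
    truePairs (isMono f₀)           ≡⟨ truePairs-closed (isMono f₀) ⟩
    pairsOf (countTrue (isMono f₀)) ≡⟨ cong pairsOf (countTrue-all (isMono f₀ ∘ suc) λ _ → refl) ⟩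
    pairsOf n                       ∎
    where
    open ≡-Reasoning
    f₀ : Fin (suc n) → List ℕ
    f₀ = label

  lower-bound : ∀ f → IsWeakIASI G f → pairsOf n ≤ monoCount G f
  lower-bound f weak = begin
    pairsOf n                      ≤⟨ pairsOf-mono n≤c ⟩
    pairsOf (countTrue (isMono f)) ≡⟨ truePairs-closed (isMono f) ⟨
    truePairs (isMono f)           ≡⟨ monoCount-complete G complete f weak ⟨
    monoCount G f                  ∎
    where
    open ≤-Reasoning
    n≤c : n ≤ countTrue (isMono f)
    n≤c = s≤s⁻¹ (countTrue-one-exception (isMono f) (one-non-mono G complete f weak))

square-loopless : ∀ {m} (G : Graph m) → Loopless (square G)
square-loopless G u v uv refl with u Fin.≟ u
square-loopless G u v () refl | yes _
... | no u≢u = u≢u refl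

-- In the square of the wheel any two distinct vertices are adjacent: the hub
-- is adjacent to everything, and two rim vertices share the hub as a neighbour.
square-wheel-complete : ∀ n → Complete (square (wheel n))
square-wheel-complete n u v u≢v with u Fin.≟ v
... | yes u≡v = ⊥-elim (u≢v u≡v)
square-wheel-complete n zero    zero    u≢v | no _ = ⊥-elim (u≢v refl)
square-wheel-complete n zero    (suc v) _   | no _ = tt
square-wheel-complete n (suc u) zero    _   | no _ = tt
square-wheel-complete n (suc u) (suc v) _   | no _ = subst T (sym (∨-zeroʳ (cycAdj n u v))) tt

mainTheorem5 : (n : ℕ) → 3 ≤ n → IsSparingNumber (square (wheel n)) ((n * (n ∸ 1)) / 2)
mainTheorem5 n _ = sparing-complete (square (wheel n)) (square-wheel-complete n) (square-loopless (wheel n))
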